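{- There exists a labeling $\ell_0^4:V(Q_4)\to\{0,1,2,3,4\}$ that percolates under the $4$-meta bootstrap process on $Q_4$ and has exactly $1$ vertex of label $1$, $3$ vertices of label $2$, $3$ vertices of label $3$, and $1$ vertex of label $4$.
   Context: $Q_d$ denotes the $d$-dimensional hypercube: vertex set $\{0,1\}^d$, two vertices adjacent iff they differ in exactly one coordinate. The $r$-meta bootstrap process on a graph $G$ starts with a labeling $\ell_0:V(G)\to\{0,\dots,r\}$ which is updated by two rules until neither applies: (Completion) if a vertex of label $i$ has at least $r-i$ neighbours of label $r$, its label becomes $r$; (Promotion) if a vertex $v$ has at least $r$ neighbours whose labels are higher than that of $v$, the label of $v$ becomes the $r$-th highest label among its neighbours. The final labeling does not depend on the order of rule applications. A labeling percolates if every vertex eventually receives label $r$. -}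

module Defs where

open import Data.Bool using (Bool; true; false; _∧_; if_then_else_; not)
open import Data.Nat using (ℕ; zero; suc; _∸_; _≤_; _<_)
open import Data.Fin using (Fin; toℕ; fromℕ)
open import Data.Fin.Properties using (≤-decTotalOrder)
import Data.Fin.Properties as FinP
open import Data.Vec using (Vec; []; _∷_)
open import Data.Vec.Properties using (≡-dec)
import Data.Bool.Properties as BoolP
open import Data.List using (List; []; _∷_; map; _++_; length; filter; filterᵇ; reverse; foldr)
open import Data.Maybe using (Maybe; just; nothing)
open import Relation.Nullary.Decidable using (⌊_⌋; does)
open import Relation.Binary.PropositionalEquality using (_≡_)
open import Data.Product using (∃; _×_)
open import Relation.Binary.Construct.Closure.ReflexiveTransitive using (Star)
import Data.List.Sort.InsertionSort.Base as InsSort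
open import Data.Nat using (_≤ᵇ_; _≡ᵇ_)

Vertex : ℕ → Set
Vertex d = Vec Bool d

allVertices : (d : ℕ) → List (Vertex d)
allVertices zero = [] ∷ []
allVertices (suc d) = map (false ∷_) (allVertices d) ++ map (true ∷_) (allVertices d)

hamming : {d : ℕ} → Vertex d → Vertex d → ℕ
hamming [] [] = 0
hamming (x ∷ xs) (y ∷ ys) = (if does (x BoolP.≟ y) then 0 else 1) Data.Nat.+ hamming xs ys

adjᵇ : {d : ℕ} → Vertex d → Vertex d → Bool
adjᵇ v w = hamming v w ≡ᵇ 1

neighbours : {d : ℕ} → Vertex d → List (Vertex d)
neighbours {d} v = filterᵇ (adjᵇ v) (allVertices d)

Labeling : ℕ → ℕ → Set
Labeling d r = Vertex d → Fin (suc r)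

countNbrs : {d : ℕ} → Vertex d → (Vertex d → Bool) → ℕ
countNbrs v P = length (filterᵇ P (neighbours v))

top : (r : ℕ) → Fin (suc r)
top r = fromℕ r

isTopᵇ : {r : ℕ} → Fin (suc r) → Bool
isTopᵇ {r} x = toℕ x ≡ᵇ r

_>ᵇ_ : {r : ℕ} → Fin (suc r) → Fin (suc r) → Bool
x >ᵇ y = suc (toℕ y) ≤ᵇ toℕ x

-- k-th highest (1-indexed) element of a list of labels, counted with
-- multiplicity: sort in increasing order, reverse, take position k.
nth : {A : Set} → ℕ → List A → Maybe A
nth _ [] = nothing
nth zero (x ∷ xs) = just x
nth (suc k) (x ∷ xs) = nth k xs

sortLabels : (r : ℕ) → List (Fin (suc r)) → List (Fin (suc r))
sortLabels r = InsSort.sort (≤-decTotalOrder (suc r))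

kthHighest : (r : ℕ) → ℕ → List (Fin (suc r)) → Maybe (Fin (suc r))
kthHighest r k xs = nth (k ∸ 1) (reverse (sortLabels r xs))

update : {d r : ℕ} → Labeling d r → Vertex d → Fin (suc r) → Labeling d r
update {d} ℓ v x w = if does (≡-dec BoolP._≟_ v w) then x else ℓ w

data Step (d r : ℕ) : Labeling d r → Labeling d r → Set where
  completion : (ℓ : Labeling d r) (v : Vertex d) →
               r ∸ toℕ (ℓ v) ≤ countNbrs v (λ w → isTopᵇ (ℓ w)) →
               Step d r ℓ (update ℓ v (top r))
  promotion : (ℓ : Labeling d r) (v : Vertex d) (x : Fin (suc r)) →
              r ≤ countNbrs v (λ w → ℓ w >ᵇ ℓ v) →
              kthHighest r r (map ℓ (neighbours v)) ≡ just x →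
              Step d r ℓ (update ℓ v x)

-- A labeling percolates under the r-meta bootstrap process on Q_d if some
-- finite sequence of rule applications gives every vertex label r.
-- (By order-independence of the final labeling this is equivalent to the
-- final labeling being identically r.)
Percolates : (d r : ℕ) → Labeling d r → Set
Percolates d r ℓ₀ =
  ∃ λ (ℓ : Labeling d r) → Star (Step d r) ℓ₀ ℓ × ((v : Vertex d) → ℓ v ≡ top r)

countLabel : {d r : ℕ} → Labeling d r → ℕ → ℕ
countLabel {d} ℓ k = length (filterᵇ (λ v → toℕ (ℓ v) ≡ᵇ k) (allVertices d))

{-# OPTIONS --safe #-}
-- Give the origin label 4 and the all-ones vertex label 1, split the middle
-- layer into the three vertices containing the first coordinate (label 3) and
-- the other three (label 2), and give the odd layers label 0.  Every odd-weight
-- vertex then sees four neighbours of higher label and is promoted to the least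
-- of them: e₁ to 3, the other unit vectors to 2, and the third layer to 1.
-- Label 4 then spreads out from the origin by completion, in the order: e₁,
-- the middle vertices above e₁, the other unit vectors, the rest of the middle
-- layer, the third layer, and finally the all-ones vertex.
module Submission where

open import Defs
open import Data.Bool using (Bool; T; false; if_then_else_)
open import Data.Bool using () renaming (true to I; false to O)
open import Data.Fin using (toℕ; #_; _≟_)
open import Data.List using (List; []; _∷_; map; _++_; filterᵇ)
open import Data.List.Relation.Unary.All using (All)
import Data.List.Relation.Unary.All as All
open import Data.List.Membership.Propositional using (_∈_)
open import Data.List.Membership.Propositional.Properties using (∈-map⁺; ∈-++⁺ˡ; ∈-++⁺ʳ)
open import Data.List.Relation.Unary.Any using (here)
open import Data.Maybe using (Maybe; just; nothing; maybe; _>>=_)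
open import Data.Nat using (ℕ; _∸_; _≤?_; _≡ᵇ_)
open import Data.Product using (∃; _×_; _,_)
open import Data.Vec using ([]; _∷_; head; countᵇ)
open import Function using (id)
open import Relation.Binary.Construct.Closure.ReflexiveTransitive using (Star; ε; _◅_)
open import Relation.Binary.PropositionalEquality using (_≡_; refl)
open import Relation.Nullary.Decidable using (Dec; yes; no; ⌊_⌋; toWitness)

∈-allVertices : {d : ℕ} (v : Vertex d) → v ∈ allVertices d
∈-allVertices []      = here refl
∈-allVertices (O ∷ v) = ∈-++⁺ˡ (∈-map⁺ (O ∷_) (∈-allVertices v))
∈-allVertices (I ∷ v) = ∈-++⁺ʳ _ (∈-map⁺ (I ∷_) (∈-allVertices v))

data Move (d : ℕ) : Set where
  complete promote : Vertex d → Move d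

module _ {d r : ℕ} where

  topNbrs higherNbrs : Labeling d r → Vertex d → ℕ
  topNbrs    ℓ v = countNbrs v (λ w → isTopᵇ (ℓ w))
  higherNbrs ℓ v = countNbrs v (λ w → ℓ w >ᵇ ℓ v)

  apply : Labeling d r → Move d → Maybe (Labeling d r)
  apply ℓ (complete v) with r ∸ toℕ (ℓ v) ≤? topNbrs ℓ v
  ... | yes _ = just (update ℓ v (top r))
  ... | no  _ = nothing
  apply ℓ (promote v) with r ≤? higherNbrs ℓ v | kthHighest r r (map ℓ (neighbours v))
  ... | yes _ | just x = just (update ℓ v x)
  ... | _     | _      = nothing

  run : Labeling d r → List (Move d) → Maybe (Labeling d r)
  run ℓ []       = just ℓ
  run ℓ (m ∷ ms) = apply ℓ m >>= λ ℓ′ → run ℓ′ ms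

  apply-step : {ℓ ℓ′ : Labeling d r} (m : Move d) → apply ℓ m ≡ just ℓ′ → Step d r ℓ ℓ′
  apply-step {ℓ} (complete v) eq with r ∸ toℕ (ℓ v) ≤? topNbrs ℓ v
  apply-step {ℓ} (complete v) refl | yes enough = completion ℓ v enough
  apply-step {ℓ} (promote v) eq
    with r ≤? higherNbrs ℓ v | kthHighest r r (map ℓ (neighbours v)) in kth
  apply-step {ℓ} (promote v) refl | yes enough | just x = promotion ℓ v x enough kth

  run-star : {ℓ ℓ′ : Labeling d r} (ms : List (Move d)) → run ℓ ms ≡ just ℓ′ →
             Star (Step d r) ℓ ℓ′
  run-star []       refl = ε
  run-star {ℓ} (m ∷ ms) eq with apply ℓ m in step
  ... | just ℓ″ = apply-step m step ◅ run-star ms eq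

  allTop? : (ℓ : Labeling d r) → Dec (All (λ v → ℓ v ≡ top r) (allVertices d))
  allTop? ℓ = All.all? (λ v → ℓ v ≟ top r) (allVertices d)

  percolatesVia : List (Move d) → Labeling d r → Bool
  percolatesVia ms ℓ = maybe (λ ℓ′ → ⌊ allTop? ℓ′ ⌋) false (run ℓ ms)

  percolatesVia-sound : (ms : List (Move d)) (ℓ : Labeling d r) →
                        T (percolatesVia ms ℓ) → Percolates d r ℓ
  percolatesVia-sound ms ℓ ok with run ℓ ms in finish
  ... | just ℓ′ = ℓ′ , run-star ms finish , λ v → All.lookup allTop (∈-allVertices v)
    where
    allTop : All (λ v → ℓ′ v ≡ top r) (allVertices d)
    allTop = toWitness {a? = allTop? ℓ′} ok

weight : {d : ℕ} → Vertex d → ℕ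
weight = countᵇ id

initial : Labeling 4 4
initial v with weight v
... | 0 = # 4
... | 2 = if head v then # 3 else # 2
... | 4 = # 1
... | _ = # 0

layer : (d : ℕ) → ℕ → List (Vertex d)
layer d k = filterᵇ (λ v → weight v ≡ᵇ k) (allVertices d)

schedule : List (Move 4)
schedule =
  map promote (layer 4 1 ++ layer 4 3) ++
  map complete
    ( (I ∷ O ∷ O ∷ O ∷ [])
    ∷ (I ∷ I ∷ O ∷ O ∷ []) ∷ (I ∷ O ∷ I ∷ O ∷ []) ∷ (I ∷ O ∷ O ∷ I ∷ [])
    ∷ (O ∷ I ∷ O ∷ O ∷ []) ∷ (O ∷ O ∷ I ∷ O ∷ []) ∷ (O ∷ O ∷ O ∷ I ∷ [])
    ∷ (O ∷ I ∷ I ∷ O ∷ []) ∷ (O ∷ I ∷ O ∷ I ∷ []) ∷ (O ∷ O ∷ I ∷ I ∷ [])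
    ∷ (I ∷ I ∷ I ∷ O ∷ []) ∷ (I ∷ I ∷ O ∷ I ∷ []) ∷ (I ∷ O ∷ I ∷ I ∷ []) ∷ (O ∷ I ∷ I ∷ I ∷ [])
    ∷ (I ∷ I ∷ I ∷ I ∷ [])
    ∷ [])

lemma5p1 : ∃ λ (ℓ₀ : Labeling 4 4) →
    Percolates 4 4 ℓ₀
    × countLabel ℓ₀ 1 ≡ 1
    × countLabel ℓ₀ 2 ≡ 3
    × countLabel ℓ₀ 3 ≡ 3
    × countLabel ℓ₀ 4 ≡ 1
lemma5p1 = initial , percolatesVia-sound schedule initial _ , refl , refl , refl , refl
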